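{- For every graph $\mathcal{G}$ with $\theta_1(\mathcal{G})\le 3$, one has $\theta^{c}(\mathcal{G})=1+\theta_1(\mathcal{G})$.
   Context: Graphs are finite, simple and undirected. For a graph $\mathcal{G}=(\mathcal{V},\mathcal{E})$ and positive integers $\alpha,\beta$, an $(\alpha\mid\beta)$-cointersection representation (CIR) of $\mathcal{G}$ consists of two disjoint finite sets of features $\mathcal{A},\mathcal{B}$ with $|\mathcal{A}|=\alpha$, $|\mathcal{B}|=\beta$, together with an assignment to each vertex $v$ of subsets $A_v\subseteq\mathcal{A}$, $B_v\subseteq\mathcal{B}$ (possibly empty), such that for all distinct $u,v\in\mathcal{V}$: $(u,v)\in\mathcal{E}$ if and only if $A_u\cap A_v\neq\varnothing$ and $B_u\cap B_v\neq\varnothing$. The cointersection number $\theta^{c}(\mathcal{G})$ is the minimum of $\alpha+\beta$ over all CIRs of $\mathcal{G}$. The intersection number $\theta_1(\mathcal{G})$ is the minimum size of a nonempty finite set $F$ for which there exist subsets $S_v\subseteq F$ (possibly empty), $v\in\mathcal{V}$, such that for distinct $u,v$: $(u,v)\in\mathcal{E}$ iff $S_u\cap S_v\ne\varnothing$. For a graph with at least one edge this equals the minimum number of cliques needed to cover all edges; for an edgeless graph it equals $1$. -}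

module Defs where

open import Data.Nat using (ℕ; _≤_; _+_)
open import Data.Bool using (Bool; true; false)
open import Data.Fin using (Fin)
open import Data.Fin.Subset using (Subset; _∩_; Nonempty)
open import Data.Product using (Σ; _×_; ∃; ∃-syntax)
open import Relation.Binary.PropositionalEquality using (_≡_; _≢_)
open import Function.Bundles using (_⇔_)

record Graph : Set where
  field
    n      : ℕ
    adj    : Fin n → Fin n → Bool
    sym    : ∀ u v → adj u v ≡ adj v u
    irrefl : ∀ v → adj v v ≡ false

open Graph public

Edge : (G : Graph) → Fin (n G) → Fin (n G) → Set
Edge G u v = adj G u v ≡ true

IsIntersectionRep : (G : Graph) (k : ℕ) → (Fin (n G) → Subset k) → Set
IsIntersectionRep G k S =
  ∀ u v → u ≢ v → (Edge G u v ⇔ Nonempty (S u ∩ S v))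

HasIntersectionRep : Graph → ℕ → Set
HasIntersectionRep G k = Σ (Fin (n G) → Subset k) (IsIntersectionRep G k)

IntersectionNumberIs : Graph → ℕ → Set
IntersectionNumberIs G t =
  (1 ≤ t × HasIntersectionRep G t) ×
  (∀ k → 1 ≤ k → HasIntersectionRep G k → t ≤ k)

-- An (α | β)-cointersection representation: A_v ⊆ Fin α, B_v ⊆ Fin β
-- (the two feature sets are disjoint by construction), with, for distinct
-- u v, (u,v) ∈ E iff A_u ∩ A_v ≠ ∅ and B_u ∩ B_v ≠ ∅.
IsCIR : (G : Graph) (α β : ℕ) → (Fin (n G) → Subset α) → (Fin (n G) → Subset β) → Set
IsCIR G α β A B =
  ∀ u v → u ≢ v →
    (Edge G u v ⇔ (Nonempty (A u ∩ A v) × Nonempty (B u ∩ B v)))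

HasCIR : Graph → ℕ → ℕ → Set
HasCIR G α β =
  Σ (Fin (n G) → Subset α) λ A → Σ (Fin (n G) → Subset β) λ B → IsCIR G α β A B

CointersectionNumberIs : Graph → ℕ → Set
CointersectionNumberIs G c =
  (∃[ α ] ∃[ β ] (1 ≤ α × 1 ≤ β × α + β ≡ c × HasCIR G α β)) ×
  (∀ α β → 1 ≤ α → 1 ≤ β → HasCIR G α β → c ≤ α + β)

module Submission where

-- Upper bound: a single feature owned by every vertex turns an
-- intersection representation over t features into a (1 | t)-CIR.
--
-- Lower bound: let (A, B) be an (α | β)-CIR with α, β ≥ 1.
--   * If α = 1, "gate" each B_v by A_v ⊆ {0}: keep B_v when 0 ∈ A_v and
--     replace it by ∅ otherwise.  The gated sets form an intersection
--     representation over β features, so t ≤ β and 1 + t ≤ α + β.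
--   * If β = 1, swap the two feature sets and argue as above.
--   * Otherwise α, β ≥ 2, so α + β ≥ 4 ≥ 1 + t because t ≤ 3.

open import Defs
open import Data.Nat using (ℕ; zero; suc; _≤_; _+_; z≤n; s≤s)
open import Data.Nat.Properties using (≤-trans; +-comm; +-mono-≤)
open import Data.Fin.Subset using (Subset; _∈_; _∩_; Nonempty; Empty; ⊥; inside; outside)
open import Data.Fin.Subset.Properties using (∉⊥; ∩-zeroˡ; ∩-zeroʳ)
open import Data.Vec using (_∷_; []; here)
open import Data.Product using (_×_; _,_; proj₂)
open import Data.Product using () renaming (swap to swap×)
open import Function.Bundles using (_⇔_; mk⇔; Equivalence)
open import Relation.Nullary using (¬_; contradiction)
open import Relation.Binary.PropositionalEquality using (_≡_; refl; subst)

open Equivalence using (to; from)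

⇔-from-empty : ∀ {a b} {A : Set a} {B : Set b} → ¬ A → ¬ B → A ⇔ B
⇔-from-empty ¬a ¬b = mk⇔ (λ x → contradiction x ¬a) (λ y → contradiction y ¬b)

empty-⊥∩ : ∀ {k} (q : Subset k) → Empty (⊥ ∩ q)
empty-⊥∩ q (x , x∈⊥∩q) = ∉⊥ (subst (x ∈_) (∩-zeroˡ q) x∈⊥∩q)

empty-∩⊥ : ∀ {k} (p : Subset k) → Empty (p ∩ ⊥)
empty-∩⊥ p (x , x∈p∩⊥) = ∉⊥ (subst (x ∈_) (∩-zeroʳ p) x∈p∩⊥)

gate : ∀ {k} → Subset 1 → Subset k → Subset k
gate (inside  ∷ []) p = p
gate (outside ∷ []) p = ⊥

gate-∩ : ∀ {k} (a b : Subset 1) (p q : Subset k) →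
  Nonempty (gate a p ∩ gate b q) ⇔ (Nonempty (a ∩ b) × Nonempty (p ∩ q))
gate-∩ (inside ∷ []) (inside ∷ []) p q =
  mk⇔ (λ p∩q≠∅ → (_ , here) , p∩q≠∅) proj₂
gate-∩ (inside ∷ []) (outside ∷ []) p q =
  ⇔-from-empty (empty-∩⊥ p) (λ (a∩b≠∅ , _) → empty-∩⊥ (inside ∷ []) a∩b≠∅)
gate-∩ (outside ∷ []) b p q =
  ⇔-from-empty (empty-⊥∩ (gate b q)) (λ (a∩b≠∅ , _) → empty-⊥∩ b a∩b≠∅)

swapCIR : (G : Graph) (α β : ℕ) → HasCIR G α β → HasCIR G β α
swapCIR G α β (A , B , cir) = B , A , λ u v u≢v →
  mk⇔ (λ e → swap× (to (cir u v u≢v) e)) (λ r → from (cir u v u≢v) (swap× r))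

rep⇒CIR₁ : (G : Graph) (k : ℕ) → HasIntersectionRep G k → HasCIR G 1 k
rep⇒CIR₁ G k (S , rep) = (λ _ → inside ∷ []) , S , λ u v u≢v →
  mk⇔ (λ e → (_ , here) , to (rep u v u≢v) e)
      (λ r → from (rep u v u≢v) (proj₂ r))

CIR₁⇒rep : (G : Graph) (k : ℕ) → HasCIR G 1 k → HasIntersectionRep G k
CIR₁⇒rep G k (A , B , cir) = (λ v → gate (A v) (B v)) , λ u v u≢v →
  let gated = gate-∩ (A u) (A v) (B u) (B v) in
  mk⇔ (λ e → from gated (to (cir u v u≢v) e))
      (λ ne → from (cir u v u≢v) (to gated ne))

CIR₁-bound : (G : Graph) (t : ℕ) → IntersectionNumberIs G t →
  ∀ k → 1 ≤ k → HasCIR G 1 k → 1 + t ≤ 1 + k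
CIR₁-bound G t (_ , minimal) k 1≤k h = s≤s (minimal k 1≤k (CIR₁⇒rep G k h))

proposition1 : (G : Graph) (t : ℕ) → IntersectionNumberIs G t → t ≤ 3 →
    CointersectionNumberIs G (1 + t)
proposition1 G t θ₁≡t@((1≤t , rep) , _) t≤3 =
  (1 , t , s≤s z≤n , 1≤t , refl , rep⇒CIR₁ G t rep) , lower
  where
  lower : ∀ α β → 1 ≤ α → 1 ≤ β → HasCIR G α β → 1 + t ≤ α + β
  lower (suc zero) β _ 1≤β h = CIR₁-bound G t θ₁≡t β 1≤β h
  lower α@(suc (suc _)) (suc zero) 1≤α _ h =
    subst (1 + t ≤_) (+-comm 1 α) (CIR₁-bound G t θ₁≡t α 1≤α (swapCIR G α 1 h))
  lower (suc (suc _)) (suc (suc _)) _ _ _ =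
    ≤-trans (s≤s t≤3) (+-mono-≤ (s≤s (s≤s z≤n)) (s≤s (s≤s z≤n)))
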